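{- Let $\mathcal{G}$ be a finite DAG and let $S,T\subseteq V(\mathcal{G})$ be disjoint sets. Then: (1) If $z\in V(\mathcal{H}(S,T))$, then $S(z)\neq\emptyset$ and $T(z)\ne\emptyset$. (2) If $z\in V(\mathcal{G})\setminus V(\mathcal{H}(S,T))$, then at most one of the following holds: (a) there exists $y\in V(\mathcal{H}(S,T))$ with $z\prec y$; (b) there exists $x\in V(\mathcal{H}(S,T))$ with $x\prec z$. (3) If $x,y\in V(\mathcal{H}(S,T))$ and $(x,y)\in E(\mathcal{G})$, then $(x,y)\in E(\mathcal{H}(S,T))$.
   Context: For a DAG $\mathcal{G}$, $x\preceq y$ iff there is a directed path from $x$ to $y$ in $\mathcal{G}$, and $x\prec y$ means $x\preceq y$, $x\ne y$. For $s,t\in V(\mathcal{G})$, $\mathcal{H}(s,t)$ is the subgraph of $\mathcal{G}$ formed by the union of all directed paths in $\mathcal{G}$ from $s$ to $t$ (empty if $s\not\preceq t$). For disjoint $S,T\subseteq V(\mathcal{G})$, the $(S,T)$-sweeping graph is $\mathcal{H}(S,T)=\bigcup_{(s,t)\in S\times T}\mathcal{H}(s,t)$. For $z\in V(\mathcal{H}(S,T))$, $S(z)=\{s\in S:s\preceq z\}$ and $T(z)=\{t\in T:z\preceq t\}$. -}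

module Defs where

open import Level using (Level; _⊔_; suc)
open import Data.Nat using (ℕ)
open import Data.Fin using (Fin)
open import Data.Fin.Subset using (Subset; _∈_)
open import Data.Product using (Σ; ∃; _×_; Σ-syntax; ∃-syntax)
open import Relation.Nullary using (¬_)
open import Relation.Binary.PropositionalEquality using (_≡_; _≢_)

module _ {n : ℕ} {ℓ : Level} (E : Fin n → Fin n → Set ℓ) where

  data Path : Fin n → Fin n → Set ℓ where
    []  : ∀ {x} → Path x x
    _∷_ : ∀ {x y z} → E x y → Path y z → Path x z

  data OnV : ∀ {x y} → Path x y → Fin n → Set ℓ where
    here  : ∀ {x y} {p : Path x y} → OnV p x
    there : ∀ {x y z w} {e : E x y} {p : Path y z} → OnV p w → OnV (e ∷ p) w

  data OnE : ∀ {x y} → Path x y → Fin n → Fin n → Set ℓ where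
    here  : ∀ {x y z} {e : E x y} {p : Path y z} → OnE (e ∷ p) x y
    there : ∀ {x y z u v} {e : E x y} {p : Path y z} → OnE p u v → OnE (e ∷ p) u v

  Acyclic : Set ℓ
  Acyclic = ∀ {x y} → E x y → ¬ Path y x

  _⪯_ : Fin n → Fin n → Set ℓ
  x ⪯ y = Path x y

  _≺_ : Fin n → Fin n → Set ℓ
  x ≺ y = x ⪯ y × x ≢ y

  -- z ∈ V(H(S,T)) : z lies on some directed path from some s ∈ S to some t ∈ T
  HV : Subset n → Subset n → Fin n → Set ℓ
  HV S T z = ∃[ s ] ∃[ t ] (s ∈ S × t ∈ T × Σ[ p ∈ Path s t ] OnV p z)

  -- (u,v) ∈ E(H(S,T)) : (u,v) is an edge of some directed path from some s ∈ S to some t ∈ T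
  HE : Subset n → Subset n → Fin n → Fin n → Set ℓ
  HE S T u v = ∃[ s ] ∃[ t ] (s ∈ S × t ∈ T × Σ[ p ∈ Path s t ] OnE p u v)

  S-of-nonempty : Subset n → Fin n → Set ℓ
  S-of-nonempty S z = ∃[ s ] (s ∈ S × s ⪯ z)

  T-of-nonempty : Subset n → Fin n → Set ℓ
  T-of-nonempty T z = ∃[ t ] (t ∈ T × z ⪯ t)

Disjoint : ∀ {n} → Subset n → Subset n → Set
Disjoint S T = ∀ v → v ∈ S → ¬ (v ∈ T)

module Submission where

-- Every claim only glues paths: a vertex of H(S,T) splits an S–T path into an
-- S-prefix and a T-suffix, and any vertex or edge sandwiched between such a
-- prefix and suffix lies on the concatenated S–T path.

open import Defs
open import Level using (Level)
open import Data.Nat using (ℕ)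
open import Data.Fin using (Fin)
open import Data.Fin.Subset using (Subset)
open import Data.Product using (_×_; ∃-syntax; _,_)
open import Relation.Nullary using (¬_)

module _ {n : ℕ} {ℓ : Level} {E : Fin n → Fin n → Set ℓ} where

  _++_ : ∀ {x y z} → Path E x y → Path E y z → Path E x z
  []      ++ q = q
  (e ∷ p) ++ q = e ∷ (p ++ q)

  splitAt : ∀ {x y z} (p : Path E x y) → OnV E p z → Path E x z × Path E z y
  splitAt p       here      = [] , p
  splitAt (e ∷ p) (there o) with splitAt p o
  ... | p₁ , p₂ = e ∷ p₁ , p₂

  ++-onV : ∀ {x y z} (p : Path E x y) (q : Path E y z) → OnV E (p ++ q) y
  ++-onV []      q = here
  ++-onV (e ∷ p) q = there (++-onV p q)

  ++-onE : ∀ {x u v y} (p : Path E x u) (e : E u v) (q : Path E v y) →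
           OnE E (p ++ (e ∷ q)) u v
  ++-onE []       e q = here
  ++-onE (e′ ∷ p) e q = there (++-onE p e q)

  module _ {S T : Subset n} where

    HV⇒S-of-nonempty : ∀ {z} → HV E S T z → S-of-nonempty E S z
    HV⇒S-of-nonempty (s , t , s∈S , t∈T , p , z∈p) with splitAt p z∈p
    ... | s⪯z , _ = s , s∈S , s⪯z

    HV⇒T-of-nonempty : ∀ {z} → HV E S T z → T-of-nonempty E T z
    HV⇒T-of-nonempty (s , t , s∈S , t∈T , p , z∈p) with splitAt p z∈p
    ... | _ , z⪯t = t , t∈T , z⪯t

    HV-between : ∀ {x y z} → HV E S T x → HV E S T y →
                 _⪯_ E x z → _⪯_ E z y → HV E S T z
    HV-between hx hy x⪯z z⪯y with HV⇒S-of-nonempty hx | HV⇒T-of-nonempty hy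
    ... | s , s∈S , s⪯x | t , t∈T , y⪯t =
      s , t , s∈S , t∈T , (s⪯x ++ x⪯z) ++ (z⪯y ++ y⪯t) , ++-onV (s⪯x ++ x⪯z) (z⪯y ++ y⪯t)

    HV-edge⇒HE : ∀ {x y} → HV E S T x → HV E S T y → E x y → HE E S T x y
    HV-edge⇒HE hx hy e with HV⇒S-of-nonempty hx | HV⇒T-of-nonempty hy
    ... | s , s∈S , s⪯x | t , t∈T , y⪯t =
      s , t , s∈S , t∈T , s⪯x ++ (e ∷ y⪯t) , ++-onE s⪯x e y⪯t

claim3p2 : ∀ {n : ℕ} {ℓ : Level} (E : Fin n → Fin n → Set ℓ) → Acyclic E →
    (S T : Subset n) → Disjoint S T →
    ((z : Fin n) → HV E S T z → S-of-nonempty E S z × T-of-nonempty E T z)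
    × ((z : Fin n) → ¬ HV E S T z →
        ¬ ((∃[ y ] (HV E S T y × _≺_ E z y)) × (∃[ x ] (HV E S T x × _≺_ E x z))))
    × ((x y : Fin n) → HV E S T x → HV E S T y → E x y → HE E S T x y)
claim3p2 E _ S T _ =
    (λ z hz → HV⇒S-of-nonempty hz , HV⇒T-of-nonempty hz)
  , (λ z z∉H ((y , hy , z⪯y , _) , (x , hx , x⪯z , _)) → z∉H (HV-between hx hy x⪯z z⪯y))
  , (λ x y → HV-edge⇒HE)
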